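{- For every $n \ge 0$, $Q(\Gamma_n,1) = p_{n+1}$ and $Q(\Gamma_n,2) = F_{n+2}$.
   Context: For $n\ge 1$, the Fibonacci cube $\Gamma_n$ has as vertices the binary strings of length $n$ with no two consecutive $1$s, adjacent iff they differ in exactly one position; $\Gamma_0$ is a single vertex. $Q_k$ is the $k$-dimensional hypercube ($Q_0$ a single vertex). A cube factor of a graph $G$ is a spanning subgraph whose components are all hypercubes $Q_k$, $k\ge 0$; it is optimal if no cube factor of $G$ has fewer components. For an optimal cube factor $\mathbf F$ of $G$, $q_k(G)$ is the number of components of $\mathbf F$ isomorphic to $Q_k$, and $Q(G,x)=\sum_{k\ge0} q_k(G)x^k$ (treated as determined by $G$). The Padovan sequence is $p_0=p_1=p_2=1$, $p_n=p_{n-2}+p_{n-3}$ for $n\ge3$. The Fibonacci numbers are $F_0=0$, $F_1=1$, $F_n=F_{n-1}+F_{n-2}$. -}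

module Defs where

open import Data.Nat using (ℕ; zero; suc; _+_; _*_; _^_; _≤_; _⊔_)
open import Data.Bool using (Bool; true; false)
open import Data.Vec using (Vec; []; _∷_)
open import Data.List using (List; length; map; filter; foldr)
open import Data.Fin using (Fin)
open import Data.Product using (Σ; ∃; _×_; _,_; proj₁)
open import Data.Unit using (⊤)
open import Data.Empty using (⊥)
open import Relation.Binary.PropositionalEquality using (_≡_)
import Data.Nat.Properties as ℕP
open import Data.List.Base using (lookup)
open import Relation.Nullary.Decidable using (⌊_⌋)

record Graph : Set₁ where
  field
    V   : Set
    Adj : V → V → Set
open Graph public

hamming : ∀ {n} → Vec Bool n → Vec Bool n → ℕ
hamming [] [] = 0
hamming (true  ∷ xs) (true  ∷ ys) = hamming xs ys
hamming (false ∷ xs) (false ∷ ys) = hamming xs ys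
hamming (true  ∷ xs) (false ∷ ys) = suc (hamming xs ys)
hamming (false ∷ xs) (true  ∷ ys) = suc (hamming xs ys)

NoConsecOnes : ∀ {n} → Vec Bool n → Set
NoConsecOnes [] = ⊤
NoConsecOnes (x ∷ []) = ⊤
NoConsecOnes (true ∷ true ∷ xs) = ⊥
NoConsecOnes (true ∷ false ∷ xs) = NoConsecOnes (false ∷ xs)
NoConsecOnes (false ∷ y ∷ xs) = NoConsecOnes (y ∷ xs)

Γ : ℕ → Graph
Γ n = record
  { V   = Σ (Vec Bool n) NoConsecOnes
  ; Adj = λ u v → hamming (proj₁ u) (proj₁ v) ≡ 1 }

-- A subgraph of G isomorphic to the hypercube Q_dim:
-- an injective map of the vertices of Q_dim into G sending cube edges to edges of G.
record CubeComponent (G : Graph) : Set where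
  field
    dim   : ℕ
    emb   : Vec Bool dim → V G
    inj   : ∀ x y → emb x ≡ emb y → x ≡ y
    edges : ∀ x y → hamming x y ≡ 1 → Adj G (emb x) (emb y)
open CubeComponent public

-- A cube factor: a (finite) list of cube components which are pairwise vertex-disjoint
-- and cover all vertices (so their union is a spanning subgraph whose components are hypercubes).
record CubeFactor (G : Graph) : Set where
  field
    comps    : List (CubeComponent G)
    covers   : ∀ (v : V G) → Σ (Fin (length comps)) λ i →
                 Σ (Vec Bool (dim (lookup comps i))) λ x → emb (lookup comps i) x ≡ v
    disjoint : ∀ (i j : Fin (length comps)) (x : Vec Bool (dim (lookup comps i)))
                 (y : Vec Bool (dim (lookup comps j))) →
                 emb (lookup comps i) x ≡ emb (lookup comps j) y → i ≡ j
open CubeFactor public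

ncomp : ∀ {G} → CubeFactor G → ℕ
ncomp F = length (comps F)

Optimal : (G : Graph) → CubeFactor G → Set
Optimal G F = ∀ (F' : CubeFactor G) → ncomp F ≤ ncomp F'

q : ∀ {G} → ℕ → CubeFactor G → ℕ
q k F = length (filter (λ c → dim c ℕP.≟ k) (comps F))

maxdim : ∀ {G} → CubeFactor G → ℕ
maxdim F = foldr (λ c m → dim c ⊔ m) 0 (comps F)

sumBelow : ℕ → (ℕ → ℕ) → ℕ
sumBelow zero f = 0
sumBelow (suc m) f = sumBelow m f + f m

-- Q(F, x) = Σ_{k ≥ 0} q_k(F) x^k  (terms with k > maxdim vanish)
Qval : ∀ {G} → CubeFactor G → ℕ → ℕ
Qval F x = sumBelow (suc (maxdim F)) (λ k → q k F * x ^ k)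

padovan : ℕ → ℕ
padovan 0 = 1
padovan 1 = 1
padovan 2 = 1
padovan (suc (suc (suc n))) = padovan (suc n) + padovan n

fib : ℕ → ℕ
fib 0 = 0
fib 1 = 1
fib (suc (suc n)) = fib (suc n) + fib n

module Submission where

-- In an injective, edge-preserving image of a hypercube inside a hypercube the
-- edges between the two halves all toggle one fixed coordinate, so by induction
-- the image has a coordinatewise largest vertex.  Hence a component of a cube
-- factor of Γ n contains at most one vertex of Γ n that is maximal for the
-- coordinatewise order.  Γ n has padovan (n + 1) maximal vertices, and
-- splitting strings as ∗0w (w ∈ Γ (n - 2)) or 010w (w ∈ Γ (n - 3)) builds a
-- cube factor with exactly that many components, so optimal factors have
-- padovan (n + 1) components, which is Q(Γ n, 1).  For any cube factor the
-- components partition the fib (n + 2) vertices, which is Q(Γ n, 2).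

open import Defs
open import Data.Nat using (ℕ; zero; suc; _+_; _*_; _^_; _≤_; _<_; _⊔_; s≤s)
import Data.Nat.Properties as ℕ
open import Data.Bool using (Bool; true; false; not; if_then_else_; f≤t; b≤b)
  renaming (_≤_ to _≤ᵇ_)
import Data.Bool.Properties as Bool
open import Data.Vec using (Vec; []; _∷_; updateAt; replicate)
import Data.Vec as Vec
open import Data.Vec.Properties
  using (∷-injectiveˡ; ∷-injectiveʳ; updateAt-updateAt; updateAt-cong; updateAt-id;
         lookup∘updateAt; lookup∘updateAt′)
open import Data.Vec.Relation.Binary.Pointwise.Inductive as Pointwise
  using (Pointwise; []; _∷_)
open import Data.Fin using (Fin; zero; suc)
import Data.Fin.Properties as Fin
open import Data.List using (List; []; _∷_; _++_; map; length; lookup; filter; foldr; concatMap)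
open import Data.List.Properties using (length-++; length-map; tabulate-lookup)
open import Data.Nat.ListAction using (sum)
open import Data.List.Relation.Unary.All as All using (All; []; _∷_)
import Data.List.Relation.Unary.All.Properties as Allₚ
open import Data.List.Relation.Unary.Any as Any using (Any; here; there)
import Data.List.Relation.Unary.Any.Properties as Anyₚ
open import Data.List.Relation.Unary.AllPairs as AllPairs using (AllPairs; []; _∷_)
import Data.List.Relation.Unary.AllPairs.Properties as AllPairsₚ
open import Data.List.Relation.Unary.Unique.Propositional using (Unique)
import Data.List.Relation.Unary.Unique.Propositional.Properties as Uniqueₚ
open import Data.List.Relation.Binary.Disjoint.Propositional using (Disjoint)
open import Data.List.Relation.Binary.Subset.Propositional using (_⊆_)
open import Data.List.Membership.Propositional using (_∈_)
open import Data.List.Membership.Propositional.Properties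
  using (∈-map⁺; ∈-map⁻; ∈-++⁺ˡ; ∈-++⁺ʳ; ∈-lookup; ∈-concat⁺′)
import Data.List.Membership.Setoid.Properties as SetoidMembership
open import Data.Product using (Σ; ∃; _×_; _,_; proj₁; proj₂)
open import Data.Sum using (inj₁; inj₂)
open import Data.Unit using (tt)
open import Data.Empty using (⊥-elim)
open import Function using (_∘_)
open import Relation.Nullary using (yes; no; does)
open import Relation.Nullary.Decidable using (dec-true; dec-false)
open import Relation.Binary.PropositionalEquality
open import Algebra.Properties.CommutativeSemigroup ℕ.+-commutativeSemigroup using (interchange)

toggle : ∀ {n} → Fin n → Vec Bool n → Vec Bool n
toggle p u = updateAt u p not

toggle-involutive : ∀ {n} (p : Fin n) u → toggle p (toggle p u) ≡ u
toggle-involutive p u = begin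
  updateAt (updateAt u p not) p not ≡⟨ updateAt-updateAt p u ⟩
  updateAt u p (not ∘ not)          ≡⟨ updateAt-cong p Bool.not-involutive u ⟩
  updateAt u p (λ b → b)            ≡⟨ updateAt-id p u ⟩
  u                                 ∎
  where open ≡-Reasoning

hamming-refl : ∀ {n} (u : Vec Bool n) → hamming u u ≡ 0
hamming-refl []          = refl
hamming-refl (true ∷ u)  = hamming-refl u
hamming-refl (false ∷ u) = hamming-refl u

hamming-∷ : ∀ {n} b (u v : Vec Bool n) → hamming (b ∷ u) (b ∷ v) ≡ hamming u v
hamming-∷ true  u v = refl
hamming-∷ false u v = refl

hamming≡0⇒≡ : ∀ {n} (u v : Vec Bool n) → hamming u v ≡ 0 → u ≡ v
hamming≡0⇒≡ []          []          h  = refl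
hamming≡0⇒≡ (true ∷ u)  (true ∷ v)  h  = cong (true ∷_) (hamming≡0⇒≡ u v h)
hamming≡0⇒≡ (false ∷ u) (false ∷ v) h  = cong (false ∷_) (hamming≡0⇒≡ u v h)
hamming≡0⇒≡ (true ∷ u)  (false ∷ v) ()
hamming≡0⇒≡ (false ∷ u) (true ∷ v)  ()

hamming≡1⇒toggle : ∀ {n} (u v : Vec Bool n) → hamming u v ≡ 1 → ∃ λ p → v ≡ toggle p u
hamming≡1⇒toggle []          []          ()
hamming≡1⇒toggle (true ∷ u)  (true ∷ v)  h =
  let p , v≡ = hamming≡1⇒toggle u v h in suc p , cong (true ∷_) v≡
hamming≡1⇒toggle (false ∷ u) (false ∷ v) h =
  let p , v≡ = hamming≡1⇒toggle u v h in suc p , cong (false ∷_) v≡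
hamming≡1⇒toggle (true ∷ u)  (false ∷ v) h =
  zero , cong (false ∷_) (sym (hamming≡0⇒≡ u v (ℕ.suc-injective h)))
hamming≡1⇒toggle (false ∷ u) (true ∷ v)  h =
  zero , cong (true ∷_) (sym (hamming≡0⇒≡ u v (ℕ.suc-injective h)))

-- Opposite sides of a square in the hypercube toggle the same coordinate.
toggle-square : ∀ {n} (a : Vec Bool n) {p q p′ l : Fin n} → p ≢ q →
                toggle p′ (toggle q a) ≢ a →
                toggle p′ (toggle q a) ≡ toggle l (toggle p a) → p′ ≡ p
toggle-square a {p} {q} {p′} {l} p≢q ≢a eq with p′ Fin.≟ p | l Fin.≟ p
... | yes p′≡p | _      = p′≡p
... | no _     | yes refl = ⊥-elim (≢a (trans eq (toggle-involutive l a)))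
... | no p′≢p  | no l≢p = ⊥-elim (Bool.not-¬ refl bitp)
  where
  open ≡-Reasoning
  bitp : Vec.lookup a p ≡ not (Vec.lookup a p)
  bitp = begin
    Vec.lookup a p                         ≡˘⟨ lookup∘updateAt′ p q p≢q a ⟩
    Vec.lookup (toggle q a) p              ≡˘⟨ lookup∘updateAt′ p p′ (p′≢p ∘ sym) (toggle q a) ⟩
    Vec.lookup (toggle p′ (toggle q a)) p  ≡⟨ cong (λ w → Vec.lookup w p) eq ⟩
    Vec.lookup (toggle l (toggle p a)) p   ≡⟨ lookup∘updateAt′ p l (l≢p ∘ sym) (toggle p a) ⟩
    Vec.lookup (toggle p a) p              ≡⟨ lookup∘updateAt p a ⟩
    not (Vec.lookup a p)                   ∎

infix 4 _≤ᵛ_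
_≤ᵛ_ : ∀ {n} → Vec Bool n → Vec Bool n → Set
_≤ᵛ_ = Pointwise _≤ᵇ_

≤ᵛ-refl : ∀ {n} {u : Vec Bool n} → u ≤ᵛ u
≤ᵛ-refl = Pointwise.refl Bool.≤-refl

≤ᵛ-trans : ∀ {n} {u v w : Vec Bool n} → u ≤ᵛ v → v ≤ᵛ w → u ≤ᵛ w
≤ᵛ-trans = Pointwise.trans Bool.≤-trans

toggle-raises : ∀ {n} (p : Fin n) u → Vec.lookup u p ≡ false → u ≤ᵛ toggle p u
toggle-raises zero    (false ∷ u) _   = f≤t ∷ ≤ᵛ-refl
toggle-raises (suc p) (b ∷ u)     bit = b≤b ∷ toggle-raises p u bit

toggle-lowers : ∀ {n} (p : Fin n) u → Vec.lookup u p ≡ true → toggle p u ≤ᵛ u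
toggle-lowers zero    (true ∷ u) _   = f≤t ∷ ≤ᵛ-refl
toggle-lowers (suc p) (b ∷ u)    bit = b≤b ∷ toggle-lowers p u bit

toggle-mono : ∀ {n} (p : Fin n) {u v} → u ≤ᵛ v → Vec.lookup u p ≡ Vec.lookup v p →
              toggle p u ≤ᵛ toggle p v
toggle-mono zero    (_   ∷ u≤v) refl = b≤b ∷ u≤v
toggle-mono (suc p) (b≤c ∷ u≤v) bit  = b≤c ∷ toggle-mono p u≤v bit

-- Hypercubes embedded in hypercubes

locallyConstant⇒constant : ∀ {k} {A : Set} (f : Vec Bool k → A) →
                           (∀ x y → hamming x y ≡ 1 → f x ≡ f y) → ∀ x y → f x ≡ f y
locallyConstant⇒constant {zero}  f f-edge []      []      = refl
locallyConstant⇒constant {suc k} f f-edge (a ∷ x) (b ∷ y) =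
  trans (locallyConstant⇒constant (f ∘ (a ∷_))
           (λ x y h → f-edge (a ∷ x) (a ∷ y) (trans (hamming-∷ a x y) h)) x y)
        (head-step a b)
  where
  head-step : ∀ a b → f (a ∷ y) ≡ f (b ∷ y)
  head-step true  true  = refl
  head-step false false = refl
  head-step true  false = f-edge (true ∷ y) (false ∷ y) (cong suc (hamming-refl y))
  head-step false true  = f-edge (false ∷ y) (true ∷ y) (cong suc (hamming-refl y))

record CubeEmbedding (k n : ℕ) : Set where
  field
    embed     : Vec Bool k → Vec Bool n
    injective : ∀ x y → embed x ≡ embed y → x ≡ y
    adjacent  : ∀ x y → hamming x y ≡ 1 → hamming (embed x) (embed y) ≡ 1
open CubeEmbedding

module _ {k n} (e : CubeEmbedding (suc k) n) where

  private
    e₀ e₁ : Vec Bool k → Vec Bool n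
    e₀ z = embed e (false ∷ z)
    e₁ z = embed e (true ∷ z)

    upper≢lower : ∀ {y z} → e₁ y ≢ e₀ z
    upper≢lower eq with injective e _ _ eq
    ... | ()

    rung : ∀ z → ∃ λ p → e₁ z ≡ toggle p (e₀ z)
    rung z = hamming≡1⇒toggle _ _ (adjacent e (false ∷ z) (true ∷ z) (cong suc (hamming-refl z)))

    rung-parallel : ∀ y y′ → hamming y y′ ≡ 1 → proj₁ (rung y′) ≡ proj₁ (rung y)
    rung-parallel y y′ h = toggle-square (e₀ y) p≢t ≢e₀y square
      where
      open ≡-Reasoning
      t,lower = hamming≡1⇒toggle _ _ (adjacent e (false ∷ y) (false ∷ y′) h)
      l,upper = hamming≡1⇒toggle _ _ (adjacent e (true ∷ y) (true ∷ y′) h)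
      t = proj₁ t,lower
      l = proj₁ l,upper
      p = proj₁ (rung y)
      p′ = proj₁ (rung y′)
      p≢t : p ≢ t
      p≢t p≡t = upper≢lower (trans (proj₂ (rung y))
                                   (trans (cong (λ r → toggle r (e₀ y)) p≡t) (sym (proj₂ t,lower))))
      ≢e₀y : toggle p′ (toggle t (e₀ y)) ≢ e₀ y
      ≢e₀y eq = upper≢lower (trans (proj₂ (rung y′)) (trans (cong (toggle p′) (proj₂ t,lower)) eq))
      square : toggle p′ (toggle t (e₀ y)) ≡ toggle l (toggle p (e₀ y))
      square = begin
        toggle p′ (toggle t (e₀ y)) ≡˘⟨ cong (toggle p′) (proj₂ t,lower) ⟩
        toggle p′ (e₀ y′)           ≡˘⟨ proj₂ (rung y′) ⟩
        e₁ y′                       ≡⟨ proj₂ l,upper ⟩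
        toggle l (e₁ y)             ≡⟨ cong (toggle l) (proj₂ (rung y)) ⟩
        toggle l (toggle p (e₀ y))  ∎

  direction : Fin n
  direction = proj₁ (rung (replicate k false))

  upper≡toggle-lower : ∀ z → embed e (true ∷ z) ≡ toggle direction (embed e (false ∷ z))
  upper≡toggle-lower z =
    trans (proj₂ (rung z))
          (cong (λ p → toggle p (e₀ z))
                (locallyConstant⇒constant (proj₁ ∘ rung) (λ y y′ h → sym (rung-parallel y y′ h))
                                          z (replicate k false)))

  lower-direction-bit : ∀ y y′ → Vec.lookup (embed e (false ∷ y)) direction
                               ≡ Vec.lookup (embed e (false ∷ y′)) direction
  lower-direction-bit = locallyConstant⇒constant (λ y → Vec.lookup (e₀ y) direction) step
    where
    step : ∀ y y′ → hamming y y′ ≡ 1 → Vec.lookup (e₀ y) direction ≡ Vec.lookup (e₀ y′) direction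
    step y y′ h = sym (trans (cong (λ w → Vec.lookup w direction) (proj₂ t,lower))
                             (lookup∘updateAt′ direction t direction≢t (e₀ y)))
      where
      t,lower = hamming≡1⇒toggle _ _ (adjacent e (false ∷ y) (false ∷ y′) h)
      t = proj₁ t,lower
      direction≢t : direction ≢ t
      direction≢t d≡t = upper≢lower (sym (trans (proj₂ t,lower)
        (trans (cong (λ r → toggle r (e₀ y)) (sym d≡t)) (sym (upper≡toggle-lower y)))))

  lowerHalf : CubeEmbedding k n
  lowerHalf = record
    { embed     = e₀
    ; injective = λ x y h → ∷-injectiveʳ (injective e _ _ h)
    ; adjacent  = λ x y → adjacent e (false ∷ x) (false ∷ y)
    }

-- The lower half has a top by induction; the upper half is the lower half
-- with one fixed coordinate toggled, which either lies above or below it.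
cube-top : ∀ {k n} (e : CubeEmbedding k n) → ∃ λ z → ∀ x → embed e x ≤ᵛ embed e z
cube-top {zero}  e = [] , λ { [] → ≤ᵛ-refl }
cube-top {suc k} e = top (Vec.lookup (lower z₀) p) refl
  where
  p = direction e
  lower = λ z → embed e (false ∷ z)
  z₀ = proj₁ (cube-top (lowerHalf e))
  below = proj₂ (cube-top (lowerHalf e))
  upper≡ = upper≡toggle-lower e
  top : ∀ b → Vec.lookup (lower z₀) p ≡ b → ∃ λ z → ∀ x → embed e x ≤ᵛ embed e z
  top false bit = true ∷ z₀ , λ
    { (false ∷ y) → ≤ᵛ-trans (below y)
                      (subst (lower z₀ ≤ᵛ_) (sym (upper≡ z₀)) (toggle-raises p (lower z₀) bit))
    ; (true ∷ y)  → subst₂ _≤ᵛ_ (sym (upper≡ y)) (sym (upper≡ z₀))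
                      (toggle-mono p (below y) (lower-direction-bit e y z₀))
    }
  top true bit = false ∷ z₀ , λ
    { (false ∷ y) → below y
    ; (true ∷ y)  → ≤ᵛ-trans
                      (subst (_≤ᵛ lower y) (sym (upper≡ y))
                             (toggle-lowers p (lower y) (trans (lower-direction-bit e y z₀) bit)))
                      (below y)
    }

Unique⇒lookup-injective : ∀ {A : Set} {xs : List A} → Unique xs →
                          ∀ i j → lookup xs i ≡ lookup xs j → i ≡ j
Unique⇒lookup-injective (_  ∷ _)    zero    zero    _ = refl
Unique⇒lookup-injective (x≢ ∷ _)    zero    (suc j) e = ⊥-elim (All.lookup x≢ (∈-lookup j) e)
Unique⇒lookup-injective (x≢ ∷ _)    (suc i) zero    e = ⊥-elim (All.lookup x≢ (∈-lookup i) (sym e))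
Unique⇒lookup-injective (_  ∷ uniq) (suc i) (suc j) e =
  cong suc (Unique⇒lookup-injective uniq i j e)

Unique⇒length≤ : ∀ {A : Set} {xs : List A} {m} → Unique xs → (f : Fin (length xs) → Fin m) →
                 (∀ {i j} → f i ≡ f j → lookup xs i ≡ lookup xs j) → length xs ≤ m
Unique⇒length≤ uniq f f-fibres =
  Fin.injective⇒≤ (λ {i} {j} e → Unique⇒lookup-injective uniq i j (f-fibres e))

Unique⇒⊆⇒length≤ : ∀ {A : Set} {xs ys : List A} → Unique xs → xs ⊆ ys → length xs ≤ length ys
Unique⇒⊆⇒length≤ uniq xs⊆ys =
  Unique⇒length≤ uniq (λ i → Any.index (xs⊆ys (∈-lookup i)))
    (λ {i} {j} → SetoidMembership.index-injective (setoid _)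
                   (xs⊆ys (∈-lookup i)) (xs⊆ys (∈-lookup j)))

Unique-map-++-map : ∀ {A B C : Set} {f : A → C} {g : B → C} {xs ys} →
                    (∀ {a a′} → f a ≡ f a′ → a ≡ a′) → (∀ {b b′} → g b ≡ g b′ → b ≡ b′) →
                    (∀ a b → f a ≢ g b) → Unique xs → Unique ys → Unique (map f xs ++ map g ys)
Unique-map-++-map {f = f} {g} f-inj g-inj f≢g uxs uys =
  Uniqueₚ.++⁺ (Uniqueₚ.map⁺ f-inj uxs) (Uniqueₚ.map⁺ g-inj uys) separated
  where
  separated : Disjoint (map f _) (map g _)
  separated (v∈f , v∈g) with ∈-map⁻ f v∈f | ∈-map⁻ g v∈g
  ... | a , _ , v≡fa | b , _ , v≡gb = f≢g a b (trans (sym v≡fa) v≡gb)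

length-map-++-map : ∀ {A B C : Set} (f : A → C) (g : B → C) xs ys →
                    length (map f xs ++ map g ys) ≡ length xs + length ys
length-map-++-map f g xs ys =
  trans (length-++ (map f xs)) (cong₂ _+_ (length-map f xs) (length-map g ys))

bitStrings : ∀ k → List (Vec Bool k)
bitStrings zero    = [] ∷ []
bitStrings (suc k) = map (false ∷_) (bitStrings k) ++ map (true ∷_) (bitStrings k)

length-bitStrings : ∀ k → length (bitStrings k) ≡ 2 ^ k
length-bitStrings zero    = refl
length-bitStrings (suc k) =
  trans (length-map-++-map _ _ (bitStrings k) (bitStrings k))
        (cong₂ _+_ (length-bitStrings k) (trans (length-bitStrings k) (sym (ℕ.+-identityʳ _))))

bitStrings-Unique : ∀ k → Unique (bitStrings k)
bitStrings-Unique zero    = [] ∷ []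
bitStrings-Unique (suc k) =
  Unique-map-++-map ∷-injectiveʳ ∷-injectiveʳ (λ _ _ ()) (bitStrings-Unique k) (bitStrings-Unique k)

∈-bitStrings : ∀ {k} (x : Vec Bool k) → x ∈ bitStrings k
∈-bitStrings []          = here refl
∈-bitStrings (false ∷ x) = ∈-++⁺ˡ (∈-map⁺ (false ∷_) (∈-bitStrings x))
∈-bitStrings (true ∷ x)  = ∈-++⁺ʳ _ (∈-map⁺ (true ∷_) (∈-bitStrings x))

Vertex : ℕ → Set
Vertex n = V (Γ n)

NoConsecOnes-irrelevant : ∀ {n} (u : Vec Bool n) (p p′ : NoConsecOnes u) → p ≡ p′
NoConsecOnes-irrelevant []                 tt tt = refl
NoConsecOnes-irrelevant (_ ∷ [])           tt tt = refl
NoConsecOnes-irrelevant (true ∷ true ∷ u)  () _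
NoConsecOnes-irrelevant (true ∷ false ∷ u) p  p′ = NoConsecOnes-irrelevant (false ∷ u) p p′
NoConsecOnes-irrelevant (false ∷ b ∷ u)    p  p′ = NoConsecOnes-irrelevant (b ∷ u) p p′

vertex-≡ : ∀ {n} {u v : Vertex n} → proj₁ u ≡ proj₁ v → u ≡ v
vertex-≡ {u = u , p} {v = .u , p′} refl = cong (u ,_) (NoConsecOnes-irrelevant u p p′)

noConsec-0∷ : ∀ {n} (u : Vec Bool n) → NoConsecOnes u → NoConsecOnes (false ∷ u)
noConsec-0∷ []      _ = tt
noConsec-0∷ (_ ∷ _) p = p

noConsec-∗0∷ : ∀ {n} b (u : Vec Bool n) → NoConsecOnes u → NoConsecOnes (b ∷ false ∷ u)
noConsec-∗0∷ true  = noConsec-0∷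
noConsec-∗0∷ false = noConsec-0∷

noConsec-tail : ∀ {n} b (u : Vec Bool n) → NoConsecOnes (b ∷ u) → NoConsecOnes u
noConsec-tail _     []          _ = tt
noConsec-tail true  (true ∷ u)  ()
noConsec-tail true  (false ∷ u) p = p
noConsec-tail false (_ ∷ u)     p = p

infixr 5 0∷_ _∷0∷_ 010∷_

0∷_ : ∀ {n} → Vertex n → Vertex (suc n)
0∷ (u , p) = false ∷ u , noConsec-0∷ u p

_∷0∷_ : ∀ {n} → Bool → Vertex n → Vertex (2 + n)
b ∷0∷ (u , p) = b ∷ false ∷ u , noConsec-∗0∷ b u p

010∷_ : ∀ {n} → Vertex n → Vertex (3 + n)
010∷ (u , p) = false ∷ true ∷ false ∷ u , noConsec-0∷ u p

0∷-injective : ∀ {n} {u v : Vertex n} → 0∷ u ≡ 0∷ v → u ≡ v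
0∷-injective h = vertex-≡ (∷-injectiveʳ (cong proj₁ h))

∷0∷-injective : ∀ {n b b′} {u v : Vertex n} → b ∷0∷ u ≡ b′ ∷0∷ v → u ≡ v
∷0∷-injective h = vertex-≡ (∷-injectiveʳ (∷-injectiveʳ (cong proj₁ h)))

010∷-injective : ∀ {n} {u v : Vertex n} → 010∷ u ≡ 010∷ v → u ≡ v
010∷-injective h = vertex-≡ (∷-injectiveʳ (∷-injectiveʳ (∷-injectiveʳ (cong proj₁ h))))

Γ-vertices : ∀ n → List (Vertex n)
Γ-vertices zero          = ([] , tt) ∷ []
Γ-vertices (suc zero)    = (false ∷ [] , tt) ∷ (true ∷ [] , tt) ∷ []
Γ-vertices (suc (suc n)) = map 0∷_ (Γ-vertices (suc n)) ++ map (true ∷0∷_) (Γ-vertices n)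

length-Γ-vertices : ∀ n → length (Γ-vertices n) ≡ fib (2 + n)
length-Γ-vertices zero          = refl
length-Γ-vertices (suc zero)    = refl
length-Γ-vertices (suc (suc n)) =
  trans (length-map-++-map 0∷_ (true ∷0∷_) (Γ-vertices (suc n)) (Γ-vertices n))
        (cong₂ _+_ (length-Γ-vertices (suc n)) (length-Γ-vertices n))

Γ-vertices-Unique : ∀ n → Unique (Γ-vertices n)
Γ-vertices-Unique zero          = [] ∷ []
Γ-vertices-Unique (suc zero)    = ((λ ()) ∷ []) ∷ [] ∷ []
Γ-vertices-Unique (suc (suc n)) =
  Unique-map-++-map 0∷-injective ∷0∷-injective (λ _ _ ())
                    (Γ-vertices-Unique (suc n)) (Γ-vertices-Unique n)

∈-Γ-vertices : ∀ {n} (v : Vertex n) → v ∈ Γ-vertices n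
∈-Γ-vertices {zero}        ([] , tt)             = here refl
∈-Γ-vertices {suc zero}    (false ∷ [] , tt)     = here refl
∈-Γ-vertices {suc zero}    (true ∷ [] , tt)      = there (here refl)
∈-Γ-vertices {suc (suc n)} (false ∷ u , p)       =
  ∈-++⁺ˡ (subst (_∈ map 0∷_ (Γ-vertices (suc n))) (vertex-≡ refl)
                (∈-map⁺ 0∷_ (∈-Γ-vertices (u , noConsec-tail false u p))))
∈-Γ-vertices {suc (suc n)} (true ∷ false ∷ u , p) =
  ∈-++⁺ʳ _ (subst (_∈ map (true ∷0∷_) (Γ-vertices n)) (vertex-≡ refl)
                  (∈-map⁺ (true ∷0∷_) (∈-Γ-vertices (u , noConsec-tail false u p))))
∈-Γ-vertices {suc (suc n)} (true ∷ true ∷ u , ())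

-- Maximal vertices and the lower bound

Maximal : ∀ {n} → Vec Bool n → Set
Maximal u = ∀ w → NoConsecOnes w → u ≤ᵛ w → w ≡ u

maximal-10∷ : ∀ {n} {r : Vec Bool n} → Maximal r → Maximal (true ∷ false ∷ r)
maximal-10∷ max (true ∷ false ∷ w) p (_ ∷ _ ∷ r≤w) =
  cong (λ z → true ∷ false ∷ z) (max w (noConsec-tail false w p) r≤w)
maximal-10∷ max (true ∷ true ∷ w)  () _
maximal-10∷ max (false ∷ _ ∷ w)    _  (() ∷ _)

maximal-010∷ : ∀ {n} {r : Vec Bool n} → Maximal r → Maximal (false ∷ true ∷ false ∷ r)
maximal-010∷ max (false ∷ true ∷ false ∷ w) p (_ ∷ _ ∷ _ ∷ r≤w) =
  cong (λ z → false ∷ true ∷ false ∷ z) (max w (noConsec-tail false w p) r≤w)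
maximal-010∷ max (true ∷ true ∷ w)          () _
maximal-010∷ max (false ∷ true ∷ true ∷ w)  () _
maximal-010∷ max (_ ∷ false ∷ w)            _  (_ ∷ () ∷ _)

Γ-maximals : ∀ n → List (Vertex n)
Γ-maximals zero                = ([] , tt) ∷ []
Γ-maximals (suc zero)          = (true ∷ [] , tt) ∷ []
Γ-maximals (suc (suc zero))    = (true ∷ false ∷ [] , tt) ∷ (false ∷ true ∷ [] , tt) ∷ []
Γ-maximals (suc (suc (suc n))) = map (true ∷0∷_) (Γ-maximals (suc n)) ++ map 010∷_ (Γ-maximals n)

length-Γ-maximals : ∀ n → length (Γ-maximals n) ≡ padovan (suc n)
length-Γ-maximals zero                = refl
length-Γ-maximals (suc zero)          = refl
length-Γ-maximals (suc (suc zero))    = refl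
length-Γ-maximals (suc (suc (suc n))) =
  trans (length-map-++-map (true ∷0∷_) 010∷_ (Γ-maximals (suc n)) (Γ-maximals n))
        (cong₂ _+_ (length-Γ-maximals (suc n)) (length-Γ-maximals n))

Γ-maximals-Unique : ∀ n → Unique (Γ-maximals n)
Γ-maximals-Unique zero                = [] ∷ []
Γ-maximals-Unique (suc zero)          = [] ∷ []
Γ-maximals-Unique (suc (suc zero))    = ((λ ()) ∷ []) ∷ [] ∷ []
Γ-maximals-Unique (suc (suc (suc n))) =
  Unique-map-++-map ∷0∷-injective 010∷-injective (λ _ _ ())
                    (Γ-maximals-Unique (suc n)) (Γ-maximals-Unique n)

Γ-maximals-Maximal : ∀ n → All (Maximal ∘ proj₁) (Γ-maximals n)
Γ-maximals-Maximal zero                = (λ { [] _ _ → refl }) ∷ []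
Γ-maximals-Maximal (suc zero)          =
  (λ { (true ∷ []) _ _ → refl ; (false ∷ []) _ (() ∷ _) }) ∷ []
Γ-maximals-Maximal (suc (suc zero))    =
  maximal-10∷ (λ { [] _ _ → refl })
  ∷ (λ { (false ∷ true ∷ []) _ _ → refl
       ; (true ∷ true ∷ [])  () _
       ; (_ ∷ false ∷ [])    _ (_ ∷ () ∷ _) })
  ∷ []
Γ-maximals-Maximal (suc (suc (suc n))) =
  Allₚ.++⁺ (Allₚ.map⁺ (All.map maximal-10∷ (Γ-maximals-Maximal (suc n))))
           (Allₚ.map⁺ (All.map maximal-010∷ (Γ-maximals-Maximal n)))

cubeEmbedding : ∀ {n} (c : CubeComponent (Γ n)) → CubeEmbedding (dim c) n
cubeEmbedding c = record
  { embed     = proj₁ ∘ emb c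
  ; injective = λ x y h → inj c x y (vertex-≡ h)
  ; adjacent  = edges c
  }

component-maximal-unique : ∀ {n} (c : CubeComponent (Γ n)) x y →
                           Maximal (proj₁ (emb c x)) → Maximal (proj₁ (emb c y)) → emb c x ≡ emb c y
component-maximal-unique c x y max-x max-y = vertex-≡ (trans (sym (top≡ x max-x)) (top≡ y max-y))
  where
  top = cube-top (cubeEmbedding c)
  z = proj₁ top
  top≡ : ∀ x → Maximal (proj₁ (emb c x)) → proj₁ (emb c z) ≡ proj₁ (emb c x)
  top≡ x max = max (proj₁ (emb c z)) (proj₂ (emb c z)) (proj₂ top x)

factor-maximal-unique : ∀ {n} (F : CubeFactor (Γ n)) {u v : Vertex n} →
                        Maximal (proj₁ u) → Maximal (proj₁ v) →
                        proj₁ (covers F u) ≡ proj₁ (covers F v) → u ≡ v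
factor-maximal-unique F {u} {v} max-u max-v same with covers F u | covers F v
... | i , x , refl | j , y , refl with refl ← same =
  component-maximal-unique (lookup (comps F) i) x y max-u max-v

padovan≤ncomp : ∀ {n} (F : CubeFactor (Γ n)) → padovan (suc n) ≤ ncomp F
padovan≤ncomp {n} F =
  subst (_≤ ncomp F) (length-Γ-maximals n)
        (Unique⇒length≤ (Γ-maximals-Unique n) (λ i → proj₁ (covers F (lookup ms i)))
                        (λ {i} {j} → factor-maximal-unique F (maximal i) (maximal j)))
  where
  ms = Γ-maximals n
  maximal : ∀ i → Maximal (proj₁ (lookup ms i))
  maximal i = All.lookup (Γ-maximals-Maximal n) (∈-lookup i)

module _ {G : Graph} where

  _∈ᶜ_ : V G → CubeComponent G → Set
  v ∈ᶜ c = ∃ λ x → emb c x ≡ v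

  Disjointᶜ : CubeComponent G → CubeComponent G → Set
  Disjointᶜ c d = ∀ x y → emb c x ≢ emb d y

  point : V G → CubeComponent G
  point v = record
    { dim = 0 ; emb = λ _ → v ; inj = λ { [] [] _ → refl } ; edges = λ { [] [] () } }

  AllPairs-Disjointᶜ⇒lookup : ∀ {cs} → AllPairs Disjointᶜ cs → ∀ i j x y →
                              emb (lookup cs i) x ≡ emb (lookup cs j) y → i ≡ j
  AllPairs-Disjointᶜ⇒lookup (_  ∷ _)  zero    zero    x y e = refl
  AllPairs-Disjointᶜ⇒lookup (c# ∷ _)  zero    (suc j) x y e =
    ⊥-elim (All.lookup c# (∈-lookup j) x y e)
  AllPairs-Disjointᶜ⇒lookup (c# ∷ _)  (suc i) zero    x y e =
    ⊥-elim (All.lookup c# (∈-lookup i) y x (sym e))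
  AllPairs-Disjointᶜ⇒lookup (_  ∷ cs#) (suc i) (suc j) x y e =
    cong suc (AllPairs-Disjointᶜ⇒lookup cs# i j x y e)

  factor-AllPairs-Disjointᶜ : (F : CubeFactor G) → AllPairs Disjointᶜ (comps F)
  factor-AllPairs-Disjointᶜ F =
    subst (AllPairs Disjointᶜ) (tabulate-lookup (comps F))
          (AllPairsₚ.tabulate⁺ (λ {i} {j} i≢j x y e → i≢j (disjoint F i j x y e)))

  cubeFactor : (cs : List (CubeComponent G)) → (∀ v → Any (v ∈ᶜ_) cs) →
               AllPairs Disjointᶜ cs → CubeFactor G
  cubeFactor cs cover cs-disjoint = record
    { comps    = cs
    ; covers   = λ v → Any.index (cover v) , Anyₚ.lookup-index (cover v)
    ; disjoint = AllPairs-Disjointᶜ⇒lookup cs-disjoint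
    }

  componentVertices : CubeComponent G → List (V G)
  componentVertices c = map (emb c) (bitStrings (dim c))

  cubePolynomial : ℕ → List (CubeComponent G) → ℕ
  cubePolynomial x cs = sum (map (λ c → x ^ dim c) cs)

  length-concatMap-componentVertices : ∀ cs →
    length (concatMap componentVertices cs) ≡ cubePolynomial 2 cs
  length-concatMap-componentVertices []       = refl
  length-concatMap-componentVertices (c ∷ cs) =
    trans (length-++ (componentVertices c))
          (cong₂ _+_ (trans (length-map (emb c) (bitStrings (dim c))) (length-bitStrings (dim c)))
                     (length-concatMap-componentVertices cs))

  concatMap-componentVertices-Unique : ∀ {cs} → AllPairs Disjointᶜ cs →
                                       Unique (concatMap componentVertices cs)
  concatMap-componentVertices-Unique {cs} cs-disjoint =
    Uniqueₚ.concat⁺ (Allₚ.map⁺ (All.universal componentVertices-Unique cs))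
                    (AllPairsₚ.map⁺ (AllPairs.map (λ {c} {d} → Disjointᶜ⇒Disjoint {c} {d})
                                                  cs-disjoint))
    where
    componentVertices-Unique : ∀ c → Unique (componentVertices c)
    componentVertices-Unique c = Uniqueₚ.map⁺ (inj c _ _) (bitStrings-Unique (dim c))
    Disjointᶜ⇒Disjoint : ∀ {c d} → Disjointᶜ c d →
                         Disjoint (componentVertices c) (componentVertices d)
    Disjointᶜ⇒Disjoint {c} {d} c#d (v∈c , v∈d) with ∈-map⁻ (emb c) v∈c | ∈-map⁻ (emb d) v∈d
    ... | x , _ , refl | y , _ , e = c#d x y e

  ∈-concatMap-componentVertices : ∀ {v c cs} → v ∈ᶜ c → c ∈ cs → v ∈ concatMap componentVertices cs
  ∈-concatMap-componentVertices {c = c} (x , refl) c∈cs =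
    ∈-concat⁺′ (∈-map⁺ (emb c) (∈-bitStrings x)) (∈-map⁺ componentVertices c∈cs)

-- An optimal cube factor of Γ n

prefix-∗0 : ∀ {n} → CubeComponent (Γ n) → CubeComponent (Γ (2 + n))
prefix-∗0 {n} c = record { dim = suc (dim c) ; emb = embed′ ; inj = injective′ ; edges = adjacent′ }
  where
  embed′ : Vec Bool (suc (dim c)) → Vertex (2 + n)
  embed′ (b ∷ x) = b ∷0∷ emb c x
  injective′ : ∀ x y → embed′ x ≡ embed′ y → x ≡ y
  injective′ (b ∷ x) (b′ ∷ y) h =
    cong₂ _∷_ (∷-injectiveˡ (cong proj₁ h)) (inj c x y (∷0∷-injective h))
  adjacent′ : ∀ x y → hamming x y ≡ 1 → hamming (proj₁ (embed′ x)) (proj₁ (embed′ y)) ≡ 1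
  adjacent′ (true ∷ x)  (true ∷ y)  h = edges c x y h
  adjacent′ (false ∷ x) (false ∷ y) h = edges c x y h
  adjacent′ (true ∷ x)  (false ∷ y) h rewrite hamming≡0⇒≡ x y (ℕ.suc-injective h) =
    cong suc (hamming-refl (proj₁ (emb c y)))
  adjacent′ (false ∷ x) (true ∷ y)  h rewrite hamming≡0⇒≡ x y (ℕ.suc-injective h) =
    cong suc (hamming-refl (proj₁ (emb c y)))

prefix-010 : ∀ {n} → CubeComponent (Γ n) → CubeComponent (Γ (3 + n))
prefix-010 c = record
  { dim   = dim c
  ; emb   = 010∷_ ∘ emb c
  ; inj   = λ x y h → inj c x y (010∷-injective h)
  ; edges = edges c
  }

Γ₁-cube : CubeComponent (Γ 1)
Γ₁-cube = record
  { dim   = 1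
  ; emb   = λ { (b ∷ []) → b ∷ [] , tt }
  ; inj   = λ { (a ∷ []) (b ∷ []) h → cong proj₁ h }
  ; edges = λ { (a ∷ []) (b ∷ []) h → h }
  }

optimalComponents : ∀ n → List (CubeComponent (Γ n))
optimalComponents zero                = point ([] , tt) ∷ []
optimalComponents (suc zero)          = Γ₁-cube ∷ []
optimalComponents (suc (suc zero))    =
  prefix-∗0 (point ([] , tt)) ∷ point (false ∷ true ∷ [] , tt) ∷ []
optimalComponents (suc (suc (suc n))) =
  map prefix-∗0 (optimalComponents (suc n)) ++ map prefix-010 (optimalComponents n)

length-optimalComponents : ∀ n → length (optimalComponents n) ≡ padovan (suc n)
length-optimalComponents zero                = refl
length-optimalComponents (suc zero)          = refl
length-optimalComponents (suc (suc zero))    = refl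
length-optimalComponents (suc (suc (suc n))) =
  trans (length-map-++-map prefix-∗0 prefix-010 (optimalComponents (suc n)) (optimalComponents n))
        (cong₂ _+_ (length-optimalComponents (suc n)) (length-optimalComponents n))

optimalComponents-cover : ∀ {n} (v : Vertex n) → Any (v ∈ᶜ_) (optimalComponents n)
optimalComponents-cover {zero}             ([] , tt)                = here ([] , refl)
optimalComponents-cover {suc zero}         (b ∷ [] , tt)            = here (b ∷ [] , refl)
optimalComponents-cover {suc (suc zero)}   (b ∷ false ∷ [] , _)     = here (b ∷ [] , vertex-≡ refl)
optimalComponents-cover {suc (suc zero)}   (false ∷ true ∷ [] , tt) = there (here ([] , refl))
optimalComponents-cover {suc (suc zero)}   (true ∷ true ∷ [] , ())
optimalComponents-cover {suc (suc (suc n))} (b ∷ false ∷ u , p) =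
  Anyₚ.++⁺ˡ (Anyₚ.map⁺ (Any.map (λ {c} → lift {c}) (optimalComponents-cover (u , tail))))
  where
  tail = noConsec-tail false u (noConsec-tail b (false ∷ u) p)
  lift : ∀ {c} → (u , tail) ∈ᶜ c → (b ∷ false ∷ u , p) ∈ᶜ prefix-∗0 c
  lift (x , e) = b ∷ x , vertex-≡ (cong (λ w → b ∷ false ∷ proj₁ w) e)
optimalComponents-cover {suc (suc (suc n))} (false ∷ true ∷ false ∷ u , p) =
  Anyₚ.++⁺ʳ (map prefix-∗0 (optimalComponents (suc n)))
            (Anyₚ.map⁺ (Any.map (λ {c} → lift {c}) (optimalComponents-cover (u , tail))))
  where
  tail = noConsec-tail false u p
  lift : ∀ {c} → (u , tail) ∈ᶜ c → (false ∷ true ∷ false ∷ u , p) ∈ᶜ prefix-010 c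
  lift (x , e) = x , vertex-≡ (cong (λ w → false ∷ true ∷ false ∷ proj₁ w) e)
optimalComponents-cover {suc (suc (suc n))} (false ∷ true ∷ true ∷ u , ())
optimalComponents-cover {suc (suc (suc n))} (true ∷ true ∷ u , ())

optimalComponents-disjoint : ∀ n → AllPairs Disjointᶜ (optimalComponents n)
optimalComponents-disjoint zero                = [] ∷ []
optimalComponents-disjoint (suc zero)          = [] ∷ []
optimalComponents-disjoint (suc (suc zero))    = ((λ { (_ ∷ []) [] () }) ∷ []) ∷ [] ∷ []
optimalComponents-disjoint (suc (suc (suc n))) =
  AllPairsₚ.++⁺ (AllPairsₚ.map⁺ (AllPairs.map (λ {c} {d} → prefix-∗0-disjoint {c} {d})
                                               (optimalComponents-disjoint (suc n))))
                (AllPairsₚ.map⁺ (AllPairs.map (λ {c} {d} → prefix-010-disjoint {c} {d})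
                                               (optimalComponents-disjoint n)))
                (Allₚ.map⁺ (All.universal (λ c → Allₚ.map⁺ (All.universal (prefixes-disjoint c) _))
                                          _))
  where
  prefix-∗0-disjoint : ∀ {c d} → Disjointᶜ c d → Disjointᶜ (prefix-∗0 c) (prefix-∗0 d)
  prefix-∗0-disjoint c#d (_ ∷ x) (_ ∷ y) e = c#d x y (∷0∷-injective e)
  prefix-010-disjoint : ∀ {c d} → Disjointᶜ c d → Disjointᶜ (prefix-010 c) (prefix-010 d)
  prefix-010-disjoint c#d x y e = c#d x y (010∷-injective e)
  prefixes-disjoint : ∀ c d → Disjointᶜ (prefix-∗0 c) (prefix-010 d)
  prefixes-disjoint c d (_ ∷ x) y ()

optimalFactor : ∀ n → CubeFactor (Γ n)
optimalFactor n =
  cubeFactor (optimalComponents n) optimalComponents-cover (optimalComponents-disjoint n)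

optimalFactor-Optimal : ∀ n → Optimal (Γ n) (optimalFactor n)
optimalFactor-Optimal n F = subst (_≤ ncomp F) (sym (length-optimalComponents n)) (padovan≤ncomp F)

Optimal⇒ncomp≡padovan : ∀ {n} (F : CubeFactor (Γ n)) → Optimal (Γ n) F → ncomp F ≡ padovan (suc n)
Optimal⇒ncomp≡padovan {n} F optimal =
  ℕ.≤-antisym (subst (ncomp F ≤_) (length-optimalComponents n) (optimal (optimalFactor n)))
              (padovan≤ncomp F)

cubePolynomial-2≡fib : ∀ {n} (F : CubeFactor (Γ n)) → cubePolynomial 2 (comps F) ≡ fib (2 + n)
cubePolynomial-2≡fib {n} F = begin
  cubePolynomial 2 (comps F)                 ≡˘⟨ length-concatMap-componentVertices (comps F) ⟩
  length (concatMap componentVertices (comps F))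
    ≡⟨ ℕ.≤-antisym (Unique⇒⊆⇒length≤ vertices-Unique (λ {v} _ → ∈-Γ-vertices v))
                   (Unique⇒⊆⇒length≤ (Γ-vertices-Unique n) (λ {v} _ → covered v)) ⟩
  length (Γ-vertices n)                      ≡⟨ length-Γ-vertices n ⟩
  fib (2 + n)                                ∎
  where
  open ≡-Reasoning
  vertices-Unique = concatMap-componentVertices-Unique (factor-AllPairs-Disjointᶜ F)
  covered : ∀ v → v ∈ concatMap componentVertices (comps F)
  covered v = let i , v∈ᶜc = covers F v in
              ∈-concatMap-componentVertices v∈ᶜc (∈-lookup {xs = comps F} i)

cubePolynomial-1≡length : ∀ {G} (cs : List (CubeComponent G)) → cubePolynomial 1 cs ≡ length cs
cubePolynomial-1≡length []       = refl
cubePolynomial-1≡length (c ∷ cs) = cong₂ _+_ (ℕ.^-zeroˡ (dim c)) (cubePolynomial-1≡length cs)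

δ : ℕ → ℕ → ℕ
δ d k = if does (d ℕ.≟ k) then 1 else 0

δ-diag : ∀ d → δ d d ≡ 1
δ-diag d = cong (if_then 1 else 0) (dec-true (d ℕ.≟ d) refl)

δ-≢ : ∀ {d k} → d ≢ k → δ d k ≡ 0
δ-≢ {d} {k} d≢k = cong (if_then 1 else 0) (dec-false (d ℕ.≟ k) d≢k)

sumBelow-cong : ∀ m {f g : ℕ → ℕ} → (∀ k → f k ≡ g k) → sumBelow m f ≡ sumBelow m g
sumBelow-cong zero    f≗g = refl
sumBelow-cong (suc m) f≗g = cong₂ _+_ (sumBelow-cong m f≗g) (f≗g m)

sumBelow-0 : ∀ m → sumBelow m (λ _ → 0) ≡ 0
sumBelow-0 zero    = refl
sumBelow-0 (suc m) = cong (_+ 0) (sumBelow-0 m)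

sumBelow-+ : ∀ m (f g : ℕ → ℕ) → sumBelow m (λ k → f k + g k) ≡ sumBelow m f + sumBelow m g
sumBelow-+ zero    f g = refl
sumBelow-+ (suc m) f g =
  trans (cong (_+ (f m + g m)) (sumBelow-+ m f g))
        (interchange (sumBelow m f) (sumBelow m g) (f m) (g m))

sumBelow-δ-vanish : ∀ {d} m (f : ℕ → ℕ) → m ≤ d → sumBelow m (λ k → δ d k * f k) ≡ 0
sumBelow-δ-vanish zero    f _   = refl
sumBelow-δ-vanish (suc m) f m<d =
  cong₂ _+_ (sumBelow-δ-vanish m f (ℕ.<⇒≤ m<d)) (cong (_* f m) (δ-≢ (ℕ.>⇒≢ m<d)))

sumBelow-δ : ∀ {d} m (f : ℕ → ℕ) → d < m → sumBelow m (λ k → δ d k * f k) ≡ f d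
sumBelow-δ (suc m) f (s≤s d≤m) with ℕ.m≤n⇒m<n∨m≡n d≤m
... | inj₁ d<m = trans (cong₂ _+_ (sumBelow-δ m f d<m) (cong (_* f m) (δ-≢ (ℕ.<⇒≢ d<m))))
                       (ℕ.+-identityʳ _)
... | inj₂ refl = trans (cong₂ _+_ (sumBelow-δ-vanish m f ℕ.≤-refl) (cong (_* f m) (δ-diag m)))
                        (ℕ.+-identityʳ (f m))

module _ {G : Graph} where

  count : ℕ → List (CubeComponent G) → ℕ
  count k cs = length (filter (λ c → dim c ℕ.≟ k) cs)

  count-∷ : ∀ k c cs → count k (c ∷ cs) ≡ δ (dim c) k + count k cs
  count-∷ k c cs with does (dim c ℕ.≟ k)
  ... | true  = refl
  ... | false = refl

  sumBelow-count : ∀ x m (cs : List (CubeComponent G)) → foldr (λ c m → dim c ⊔ m) 0 cs < m →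
                   sumBelow m (λ k → count k cs * x ^ k) ≡ cubePolynomial x cs
  sumBelow-count x m []       _  = sumBelow-0 m
  sumBelow-count x m (c ∷ cs) lt = begin
    sumBelow m (λ k → count k (c ∷ cs) * x ^ k)
      ≡⟨ sumBelow-cong m (λ k → trans (cong (_* x ^ k) (count-∷ k c cs))
                                       (ℕ.*-distribʳ-+ (x ^ k) (δ (dim c) k) (count k cs))) ⟩
    sumBelow m (λ k → δ (dim c) k * x ^ k + count k cs * x ^ k)
      ≡⟨ sumBelow-+ m _ _ ⟩
    sumBelow m (λ k → δ (dim c) k * x ^ k) + sumBelow m (λ k → count k cs * x ^ k)
      ≡⟨ cong₂ _+_ (sumBelow-δ m (x ^_) (ℕ.≤-<-trans (ℕ.m≤m⊔n (dim c) _) lt))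
                   (sumBelow-count x m cs (ℕ.≤-<-trans (ℕ.m≤n⊔m (dim c) _) lt)) ⟩
    x ^ dim c + cubePolynomial x cs
      ∎
    where open ≡-Reasoning

  Qval≡cubePolynomial : (F : CubeFactor G) (x : ℕ) → Qval F x ≡ cubePolynomial x (comps F)
  Qval≡cubePolynomial F x = sumBelow-count x (suc (maxdim F)) (comps F) ℕ.≤-refl

corollary2p4 : (n : ℕ) →
    Σ (CubeFactor (Γ n)) (Optimal (Γ n)) ×
    ((F : CubeFactor (Γ n)) → Optimal (Γ n) F →
      (Qval F 1 ≡ padovan (n + 1)) × (Qval F 2 ≡ fib (n + 2)))
corollary2p4 n = (optimalFactor n , optimalFactor-Optimal n) , λ F optimal →
  (begin
     Qval F 1                   ≡⟨ Qval≡cubePolynomial F 1 ⟩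
     cubePolynomial 1 (comps F) ≡⟨ cubePolynomial-1≡length (comps F) ⟩
     ncomp F                    ≡⟨ Optimal⇒ncomp≡padovan F optimal ⟩
     padovan (1 + n)            ≡⟨ cong padovan (ℕ.+-comm 1 n) ⟩
     padovan (n + 1)            ∎) ,
  (begin
     Qval F 2                   ≡⟨ Qval≡cubePolynomial F 2 ⟩
     cubePolynomial 2 (comps F) ≡⟨ cubePolynomial-2≡fib F ⟩
     fib (2 + n)                ≡⟨ cong fib (ℕ.+-comm 2 n) ⟩
     fib (n + 2)                ∎)
  where open ≡-Reasoning
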